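{- Let $T$ and $T'$ be alternative tableaux labeled by disjoint sets $L$ and $L'$, and let $T''=\operatorname{merge}(T,T')$. Then: 1. $T''$ is an alternative tableau. 2. If $k\in Free(T'')$, then either $k\in Free(T)$ and $T''[k]=T[k]$, or $k\in Free(T')$ and $T''[k]=T'[k]$. 3. $\operatorname{merge}(T,T')=\operatorname{merge}(T',T)$. 4. If $T_1,T_2,T_3$ are alternative tableaux labeled by pairwise disjoint sets, then $\operatorname{merge}(T_1,\operatorname{merge}(T_2,T_3))=\operatorname{merge}(\operatorname{merge}(T_1,T_2),T_3)$.
   Context: A shape of length $n$ is a Ferrers diagram in English notation, possibly with empty rows or columns. It is determined by its south-east border, a path of $n$ unit south/west steps from the top-right corner to the bottom-left corner. South steps correspond to rows and west steps to columns. The shape is labeled by a set of integers $L=\{i_1<\dots<i_n\}$ if $i_1,\dots,i_n$ are attached to the rows and columns in the order in which their steps occur along the south-east border from top-right to bottom-left. A labeled shape is thus determined by its label set together with the information of which labels are rows and which are columns. A cell in row $i$ and column $j$ exists iff $i<j$; it is denoted $(i,j)$. An alternative tableau is a shape with a partial filling of cells by left arrows and up arrows such that every cell to the left of a left arrow in its row, and every cell above an up arrow in its column, is empty. A free row is a row with no left arrow; a free column is a column with no up arrow. $Free(T)$ is the set of labels of free rows and free columns. For $k\in Free(T)$, $T(k)$ is the smallest $X\subseteq L$ with $k\in X$ such that, for every cell $(i,j)$ containing an arrow, $i\in X$ iff $j\in X$. For $A\subseteq L$, $T[A]$ is the labeled tableau with label set $A$ in which $l\in A$ labels a row (resp. column)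 iff it does so in $T$, and each cell $(i,j)$ has the same filling as in $T$. We write $T[k]:=T[T(k)]$. For $T,T'$ labeled by disjoint sets $L,L'$, $\operatorname{merge}(T,T')$ is the labeled tableau with label set $L\cup L'$, where a label is a row iff it labels a row in $T$ or in $T'$. Its cell $(i,j)$ is filled as follows: - with a left arrow (resp. up arrow) if $i,j\in L$ and $(i,j)$ is a left arrow (resp. up arrow) in $T$; - with a left arrow (resp. up arrow) if $i,j\in L'$ and $(i,j)$ is a left arrow (resp. up arrow) in $T'$; - empty otherwise. -}

module Defs where

open import Data.Integer using (ℤ; _<_)
open import Data.List using (List)
open import Data.List.Membership.Propositional using (_∈_)
open import Data.Product using (Σ; ∃; _×_; _,_)
open import Data.Sum using (_⊎_)
open import Data.Empty using (⊥)
open import Relation.Nullary using (¬_)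
open import Function.Bundles using (_⇔_)

-- Lab  l    : l belongs to the label set L
--   Row  l    : the label l (in L) labels a row; otherwise it labels a column
--   Left i j  : cell (i,j) contains a left arrow
--   Up   i j  : cell (i,j) contains an up arrow
-- Row/Left/Up are only meaningful on labels / existing cells; everything
-- else is ignored (in particular by the equality _≈T_ below).
record LTab : Set₁ where
  field
    Lab  : ℤ → Set
    Row  : ℤ → Set
    Left : ℤ → ℤ → Set
    Up   : ℤ → ℤ → Set
open LTab public

Col : LTab → ℤ → Set
Col T l = Lab T l × ¬ Row T l

IsCell : LTab → ℤ → ℤ → Set
IsCell T i j = Lab T i × Row T i × Col T j × i < j

EmptyCell : LTab → ℤ → ℤ → Set
EmptyCell T i j = ¬ Left T i j × ¬ Up T i j

Arrow : LTab → ℤ → ℤ → Set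
Arrow T i j = IsCell T i j × (Left T i j ⊎ Up T i j)

FiniteLabels : LTab → Set
FiniteLabels T = Σ (List ℤ) λ xs → ∀ l → Lab T l → l ∈ xs

-- Alternative tableau.  Columns further to the left have larger labels,
-- rows further up have smaller labels.
record IsAlternative (T : LTab) : Set where
  field
    finite     : FiniteLabels T
    oneArrow   : ∀ i j → IsCell T i j → Left T i j → Up T i j → ⊥
    leftEmpty  : ∀ i j j' → IsCell T i j → Left T i j →
                 IsCell T i j' → j < j' → EmptyCell T i j'
    upEmpty    : ∀ i i' j → IsCell T i j → Up T i j →
                 IsCell T i' j → i' < i → EmptyCell T i' j

FreeRow : LTab → ℤ → Set
FreeRow T i = Lab T i × Row T i × ¬ (∃ λ j → IsCell T i j × Left T i j)

FreeCol : LTab → ℤ → Set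
FreeCol T j = Col T j × ¬ (∃ λ i → IsCell T i j × Up T i j)

Free : LTab → ℤ → Set
Free T k = FreeRow T k ⊎ FreeCol T k

-- T(k): the smallest set X containing k such that for every arrow cell (i,j),
-- i ∈ X iff j ∈ X (inductive closure).
data Comp (T : LTab) (k : ℤ) : ℤ → Set where
  here : Comp T k k
  fwd  : ∀ {i j} → Arrow T i j → Comp T k i → Comp T k j
  bwd  : ∀ {i j} → Arrow T i j → Comp T k j → Comp T k i

restrict : LTab → (ℤ → Set) → LTab
restrict T A = record
  { Lab  = λ l → Lab T l × A l
  ; Row  = Row T
  ; Left = Left T
  ; Up   = Up T
  }

sub : LTab → ℤ → LTab
sub T k = restrict T (Comp T k)

Disjoint : LTab → LTab → Set
Disjoint T U = ∀ l → Lab T l → Lab U l → ⊥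

merge : LTab → LTab → LTab
merge T U = record
  { Lab  = λ l → Lab T l ⊎ Lab U l
  ; Row  = λ l → (Lab T l × Row T l) ⊎ (Lab U l × Row U l)
  ; Left = λ i j → (Lab T i × Lab T j × Left T i j) ⊎ (Lab U i × Lab U j × Left U i j)
  ; Up   = λ i j → (Lab T i × Lab T j × Up T i j) ⊎ (Lab U i × Lab U j × Up U i j)
  }

record _≈T_ (T U : LTab) : Set where
  field
    lab  : ∀ l → Lab T l ⇔ Lab U l
    row  : ∀ l → Lab T l → (Row T l ⇔ Row U l)
    left : ∀ i j → IsCell T i j → (Left T i j ⇔ Left U i j)
    up   : ∀ i j → IsCell T i j → (Up T i j ⇔ Up U i j)

module Submission where

-- Call T a *block* of M when every label of T is a label of M,
-- M and T agree on which of these labels are rows, and an arrow of M that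
-- touches a label of T (in its row or in its column) has both endpoints in
-- T and is an arrow of T, and conversely.  A block is thus a union of
-- connected components of the arrow graph of M.  From this notion alone:
--   * arrows, and hence components T(k), transfer between M and a block T;
--   * a free label of M lying in T is free in T, and M[k] = T[k];
--   * the alternative-tableau axioms of M at a cell follow from those of
--     a block containing the row (or the column) of that cell.
-- Since the fields of merge(T,U) are "merged" predicates that are P on the
-- T-labels and Q on the U-labels, both T and U are blocks of merge(T,U) when
-- their labels are disjoint; with the label set covered by T and U, parts 1
-- and 2 follow.  Parts 3 and 4 (commutativity, associativity) are pure
-- rearrangements of disjoint unions and need no hypotheses at all.

open import Defs
open import Data.Integer using (ℤ; _<_)
open import Data.Product using (_×_; _,_; proj₁; proj₂)
open import Data.Sum using (_⊎_; inj₁; inj₂; [_,_]; [_,_]′; swap; assocˡ; assocʳ)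
import Data.Sum as Sum
open import Data.Empty using (⊥; ⊥-elim)
open import Data.List using (_++_)
open import Data.List.Membership.Propositional.Properties using (∈-++⁺ˡ; ∈-++⁺ʳ)
open import Function using (_∘_)
open import Function.Bundles using (_⇔_; mk⇔; Equivalence)

open Equivalence using (to; from)

Disjointᴾ : (A B : ℤ → Set) → Set
Disjointᴾ A B = ∀ l → A l → B l → ⊥

disjoint-sym : ∀ {A B} → Disjointᴾ A B → Disjointᴾ B A
disjoint-sym d l b a = d l a b

MergedPred : (A B P Q : ℤ → Set) → ℤ → Set
MergedPred A B P Q l = (A l × P l) ⊎ (B l × Q l)

MergedRel : (A B : ℤ → Set) (P Q : ℤ → ℤ → Set) → ℤ → ℤ → Set
MergedRel A B P Q i j = (A i × A j × P i j) ⊎ (B i × B j × Q i j)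

record Embeds (A : ℤ → Set) (R S : ℤ → ℤ → Set) : Set where
  field
    reflect  : ∀ {i j} → A i ⊎ A j → S i j → A i × A j × R i j
    preserve : ∀ {i j} → A i → A j → R i j → S i j
open Embeds

embedded⇔ : ∀ {A R S i j} → Embeds A R S → A i → A j → S i j ⇔ R i j
embedded⇔ e ai aj = mk⇔ (proj₂ ∘ proj₂ ∘ reflect e (inj₁ ai)) (preserve e ai aj)

mergedPredˡ : ∀ {A B P Q l} → Disjointᴾ A B → A l → MergedPred A B P Q l ⇔ P l
mergedPredˡ {A} {B} {P} {Q} {l} d a = mk⇔ onA (λ p → inj₁ (a , p))
  where
  onA : MergedPred A B P Q l → P l
  onA (inj₁ (_ , p)) = p
  onA (inj₂ (b , _)) = ⊥-elim (d _ a b)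

mergedPredʳ : ∀ {A B P Q l} → Disjointᴾ A B → B l → MergedPred A B P Q l ⇔ Q l
mergedPredʳ {P = P} {Q} d b =
  let e = mergedPredˡ {P = Q} {P} (disjoint-sym d) b in mk⇔ (to e ∘ swap) (swap ∘ from e)

mergedRelˡ : ∀ {A B P Q} → Disjointᴾ A B → Embeds A P (MergedRel A B P Q)
mergedRelˡ {A} {B} {P} {Q} d = record { reflect = onA ; preserve = λ ai aj p → inj₁ (ai , aj , p) }
  where
  onA : ∀ {i j} → A i ⊎ A j → MergedRel A B P Q i j → A i × A j × P i j
  onA _ (inj₁ x) = x
  onA (inj₁ ai) (inj₂ (bi , _)) = ⊥-elim (d _ ai bi)
  onA (inj₂ aj) (inj₂ (_ , bj , _)) = ⊥-elim (d _ aj bj)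

mergedRelʳ : ∀ {A B P Q} → Disjointᴾ A B → Embeds B Q (MergedRel A B P Q)
mergedRelʳ {P = P} {Q} d = let e = mergedRelˡ {P = Q} {P} (disjoint-sym d) in
  record { reflect = λ t → reflect e t ∘ swap ; preserve = λ bi bj q → inj₂ (bi , bj , q) }

record Block (T M : LTab) : Set where
  field
    lab⊆ : ∀ {l} → Lab T l → Lab M l
    row⇔ : ∀ {l} → Lab T l → Row M l ⇔ Row T l
    left : Embeds (Lab T) (Left T) (Left M)
    up   : Embeds (Lab T) (Up T) (Up M)

blockˡ : ∀ {T U} → Disjoint T U → Block T (merge T U)
blockˡ {T} {U} d = record
  { lab⊆ = inj₁
  ; row⇔ = mergedPredˡ {P = Row T} {Row U} d
  ; left = mergedRelˡ {P = Left T} {Left U} d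
  ; up   = mergedRelˡ {P = Up T} {Up U} d
  }

blockʳ : ∀ {T U} → Disjoint T U → Block U (merge T U)
blockʳ {T} {U} d = record
  { lab⊆ = inj₂
  ; row⇔ = mergedPredʳ {P = Row T} {Row U} d
  ; left = mergedRelʳ {P = Left T} {Left U} d
  ; up   = mergedRelʳ {P = Up T} {Up U} d
  }

cellRow : ∀ {T i j} → IsCell T i j → Lab T i
cellRow (li , _) = li

cellCol : ∀ {T i j} → IsCell T i j → Lab T j
cellCol (_ , _ , (lj , _) , _) = lj

module BlockProperties {T M : LTab} (b : Block T M) where
  open Block b

  cell⁺ : ∀ {i j} → IsCell T i j → IsCell M i j
  cell⁺ (li , ri , (lj , nrj) , i<j) = lab⊆ li , from (row⇔ li) ri , (lab⊆ lj , nrj ∘ to (row⇔ lj)) , i<j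

  cell⁻ : ∀ {i j} → Lab T i → Lab T j → IsCell M i j → IsCell T i j
  cell⁻ li lj (_ , ri , (_ , nrj) , i<j) = li , to (row⇔ li) ri , (lj , nrj ∘ from (row⇔ lj)) , i<j

  arrow⁺ : ∀ {i j} → Arrow T i j → Arrow M i j
  arrow⁺ (c , inj₁ x) = cell⁺ c , inj₁ (preserve left (cellRow {T} c) (cellCol {T} c) x)
  arrow⁺ (c , inj₂ y) = cell⁺ c , inj₂ (preserve up (cellRow {T} c) (cellCol {T} c) y)

  arrow⁻ : ∀ {i j} → Lab T i ⊎ Lab T j → Arrow M i j → Lab T i × Lab T j × Arrow T i j
  arrow⁻ t (c , inj₁ x) = let (li , lj , x') = reflect left t x in li , lj , cell⁻ li lj c , inj₁ x'
  arrow⁻ t (c , inj₂ y) = let (li , lj , y') = reflect up t y in li , lj , cell⁻ li lj c , inj₂ y'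

  comp⁺ : ∀ {k l} → Comp T k l → Comp M k l
  comp⁺ here      = here
  comp⁺ (fwd a c) = fwd (arrow⁺ a) (comp⁺ c)
  comp⁺ (bwd a c) = bwd (arrow⁺ a) (comp⁺ c)

  comp⁻ : ∀ {k l} → Lab T k → Comp M k l → Lab T l × Comp T k l
  comp⁻ lk here      = lk , here
  comp⁻ lk (fwd a c) = let (li , c') = comp⁻ lk c ; (_ , lj , a') = arrow⁻ (inj₁ li) a in lj , fwd a' c'
  comp⁻ lk (bwd a c) = let (lj , c') = comp⁻ lk c ; (li , _ , a') = arrow⁻ (inj₂ lj) a in li , bwd a' c'

  free⁻ : ∀ {k} → Lab T k → Free M k → Free T k
  free⁻ lk (inj₁ (_ , rk , noLeft)) = inj₁ (lk , to (row⇔ lk) rk ,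
    λ (j , c , x) → noLeft (j , cell⁺ c , preserve left lk (cellCol {T} c) x))
  free⁻ lk (inj₂ ((_ , nrk) , noUp)) = inj₂ ((lk , nrk ∘ from (row⇔ lk)) ,
    λ (i , c , y) → noUp (i , cell⁺ c , preserve up (cellRow {T} c) lk y))

  sub≈ : ∀ {k} → Lab T k → sub M k ≈T sub T k
  sub≈ {k} lk = record
    { lab  = λ _ → mk⇔ (comp⁻ lk ∘ proj₂) (λ (lt , c) → lab⊆ lt , comp⁺ c)
    ; row  = λ _ (_ , c) → row⇔ (inT c)
    ; left = λ _ _ ((_ , ci) , _ , ((_ , cj) , _) , _) → embedded⇔ left (inT ci) (inT cj)
    ; up   = λ _ _ ((_ , ci) , _ , ((_ , cj) , _) , _) → embedded⇔ up (inT ci) (inT cj)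
    }
    where
    inT : ∀ {l} → Comp M k l → Lab T l
    inT = proj₁ ∘ comp⁻ lk

  emptyAt : ∀ {i j} → Lab T i ⊎ Lab T j → (Lab T i → Lab T j → EmptyCell T i j) → EmptyCell M i j
  emptyAt t e = (λ x → let (li , lj , x') = reflect left t x in proj₁ (e li lj) x')
              , (λ y → let (li , lj , y') = reflect up t y in proj₂ (e li lj) y')

  module _ (alt : IsAlternative T) where
    open IsAlternative alt

    oneArrowAt : ∀ {i j} → Lab T i → IsCell M i j → Left M i j → Up M i j → ⊥
    oneArrowAt li c x y =
      let (_ , lj , x') = reflect left (inj₁ li) x ; (_ , _ , y') = reflect up (inj₁ li) y
      in oneArrow _ _ (cell⁻ li lj c) x' y'

    leftEmptyAt : ∀ {i j j'} → Lab T i → IsCell M i j → Left M i j →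
                  IsCell M i j' → j < j' → EmptyCell M i j'
    leftEmptyAt li c x c' j<j' =
      let (_ , lj , x') = reflect left (inj₁ li) x
      in emptyAt (inj₁ li) (λ _ lj' → leftEmpty _ _ _ (cell⁻ li lj c) x' (cell⁻ li lj' c') j<j')

    upEmptyAt : ∀ {i i' j} → Lab T j → IsCell M i j → Up M i j →
                IsCell M i' j → i' < i → EmptyCell M i' j
    upEmptyAt lj c y c' i'<i =
      let (li , _ , y') = reflect up (inj₂ lj) y
      in emptyAt (inj₂ lj) (λ li' _ → upEmpty _ _ _ (cell⁻ li lj c) y' (cell⁻ li' lj c') i'<i)

alternativeOfBlocks : ∀ {T U M} → Block T M → Block U M →
                      (∀ {l} → Lab M l → Lab T l ⊎ Lab U l) → FiniteLabels M →
                      IsAlternative T → IsAlternative U → IsAlternative M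
alternativeOfBlocks {M = M} bT bU cover fin altT altU = record
  { finite    = fin
  ; oneArrow  = λ i j c →
      [ T.oneArrowAt altT {i} {j} , U.oneArrowAt altU {i} {j} ]′ (cover (cellRow {M} c)) c
  ; leftEmpty = λ i j j' c →
      [ T.leftEmptyAt altT {i} {j} {j'} , U.leftEmptyAt altU {i} {j} {j'} ]′ (cover (cellRow {M} c)) c
  ; upEmpty   = λ i i' j c →
      [ T.upEmptyAt altT {i} {i'} {j} , U.upEmptyAt altU {i} {i'} {j} ]′ (cover (cellCol {M} c)) c
  }
  where
  module T = BlockProperties bT
  module U = BlockProperties bU

finiteMerge : ∀ {T U} → FiniteLabels T → FiniteLabels U → FiniteLabels (merge T U)
finiteMerge (xs , f) (ys , g) = xs ++ ys , λ l → [ ∈-++⁺ˡ ∘ f l , ∈-++⁺ʳ xs ∘ g l ]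

mergeAlternative : ∀ {T U} → IsAlternative T → IsAlternative U → Disjoint T U →
                   IsAlternative (merge T U)
mergeAlternative {T} {U} altT altU d =
  alternativeOfBlocks (blockˡ {T} {U} d) (blockʳ {T} {U} d) (λ lab → lab)
    (finiteMerge {T} {U} (IsAlternative.finite altT) (IsAlternative.finite altU)) altT altU

freeLabel : ∀ {M k} → Free M k → Lab M k
freeLabel (inj₁ (lk , _))       = lk
freeLabel (inj₂ ((lk , _) , _)) = lk

mergeFree : ∀ {T U} → Disjoint T U → ∀ k → Free (merge T U) k →
            (Free T k × sub (merge T U) k ≈T sub T k) ⊎ (Free U k × sub (merge T U) k ≈T sub U k)
mergeFree {T} {U} d k f = Sum.map (fromBlock (blockˡ d)) (fromBlock (blockʳ d)) (freeLabel {merge T U} f)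
  where
  fromBlock : ∀ {S} → Block S (merge T U) → Lab S k → Free S k × sub (merge T U) k ≈T sub S k
  fromBlock b lk = BlockProperties.free⁻ b lk f , BlockProperties.sub≈ b lk

mergeComm : ∀ T U → merge T U ≈T merge U T
mergeComm T U = record
  { lab  = λ _ → mk⇔ swap swap
  ; row  = λ _ _ → mk⇔ swap swap
  ; left = λ _ _ _ → mk⇔ swap swap
  ; up   = λ _ _ _ → mk⇔ swap swap
  }

module _ {A₁ A₂ A₃ : ℤ → Set} where
  private
    A₂₃ A₁₂ : ℤ → Set
    A₂₃ x = A₂ x ⊎ A₃ x
    A₁₂ x = A₁ x ⊎ A₂ x

  mergedPred-assoc : ∀ {P₁ P₂ P₃ : ℤ → Set} {l} →
    MergedPred A₁ A₂₃ P₁ (MergedPred A₂ A₃ P₂ P₃) l ⇔ MergedPred A₁₂ A₃ (MergedPred A₁ A₂ P₁ P₂) P₃ l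
  mergedPred-assoc {P₁} {P₂} {P₃} {l} = mk⇔ forward backward
    where
    forward : MergedPred A₁ A₂₃ P₁ (MergedPred A₂ A₃ P₂ P₃) l → MergedPred A₁₂ A₃ (MergedPred A₁ A₂ P₁ P₂) P₃ l
    forward (inj₁ x@(a , _))            = inj₁ (inj₁ a , inj₁ x)
    forward (inj₂ (_ , inj₁ x@(a , _))) = inj₁ (inj₂ a , inj₂ x)
    forward (inj₂ (_ , inj₂ x))         = inj₂ x
    backward : MergedPred A₁₂ A₃ (MergedPred A₁ A₂ P₁ P₂) P₃ l → MergedPred A₁ A₂₃ P₁ (MergedPred A₂ A₃ P₂ P₃) l
    backward (inj₁ (_ , inj₁ x))         = inj₁ x
    backward (inj₁ (_ , inj₂ x@(a , _))) = inj₂ (inj₁ a , inj₁ x)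
    backward (inj₂ x@(a , _))            = inj₂ (inj₂ a , inj₂ x)

  mergedRel-assoc : ∀ {P₁ P₂ P₃ : ℤ → ℤ → Set} {i j} →
    MergedRel A₁ A₂₃ P₁ (MergedRel A₂ A₃ P₂ P₃) i j ⇔ MergedRel A₁₂ A₃ (MergedRel A₁ A₂ P₁ P₂) P₃ i j
  mergedRel-assoc {P₁} {P₂} {P₃} {i} {j} = mk⇔ forward backward
    where
    forward : MergedRel A₁ A₂₃ P₁ (MergedRel A₂ A₃ P₂ P₃) i j → MergedRel A₁₂ A₃ (MergedRel A₁ A₂ P₁ P₂) P₃ i j
    forward (inj₁ x@(ai , aj , _))            = inj₁ (inj₁ ai , inj₁ aj , inj₁ x)
    forward (inj₂ (_ , _ , inj₁ x@(ai , aj , _))) = inj₁ (inj₂ ai , inj₂ aj , inj₂ x)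
    forward (inj₂ (_ , _ , inj₂ x))           = inj₂ x
    backward : MergedRel A₁₂ A₃ (MergedRel A₁ A₂ P₁ P₂) P₃ i j → MergedRel A₁ A₂₃ P₁ (MergedRel A₂ A₃ P₂ P₃) i j
    backward (inj₁ (_ , _ , inj₁ x))           = inj₁ x
    backward (inj₁ (_ , _ , inj₂ x@(ai , aj , _))) = inj₂ (inj₁ ai , inj₁ aj , inj₁ x)
    backward (inj₂ x@(ai , aj , _))            = inj₂ (inj₂ ai , inj₂ aj , inj₂ x)

mergeAssoc : ∀ T₁ T₂ T₃ → merge T₁ (merge T₂ T₃) ≈T merge (merge T₁ T₂) T₃
mergeAssoc T₁ T₂ T₃ = record
  { lab  = λ _ → mk⇔ assocˡ assocʳ
  ; row  = λ _ _ → mergedPred-assoc {A₁ = Lab T₁} {Lab T₂} {Lab T₃} {P₁ = Row T₁} {Row T₂} {Row T₃}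
  ; left = λ _ _ _ → mergedRel-assoc {A₁ = Lab T₁} {Lab T₂} {Lab T₃} {P₁ = Left T₁} {Left T₂} {Left T₃}
  ; up   = λ _ _ _ → mergedRel-assoc {A₁ = Lab T₁} {Lab T₂} {Lab T₃} {P₁ = Up T₁} {Up T₂} {Up T₃}
  }

proposition2p13 :
    (∀ (T T' : LTab) → IsAlternative T → IsAlternative T' → Disjoint T T' →
      IsAlternative (merge T T')
      × (∀ (k : ℤ) → Free (merge T T') k →
           (Free T k × sub (merge T T') k ≈T sub T k)
           ⊎ (Free T' k × sub (merge T T') k ≈T sub T' k))
      × merge T T' ≈T merge T' T)
    × (∀ (T₁ T₂ T₃ : LTab) → IsAlternative T₁ → IsAlternative T₂ → IsAlternative T₃ →
      Disjoint T₁ T₂ → Disjoint T₁ T₃ → Disjoint T₂ T₃ →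
      merge T₁ (merge T₂ T₃) ≈T merge (merge T₁ T₂) T₃)
proposition2p13 =
  (λ T T' altT altT' d → mergeAlternative altT altT' d , mergeFree d , mergeComm T T') ,
  (λ T₁ T₂ T₃ _ _ _ _ _ _ → mergeAssoc T₁ T₂ T₃)
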